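{- Let $W\in\{\mathrm{CWV},\mathrm{WV}\}$ and let $\Pi_1=(\mathcal{A},\mathcal{E},\mathcal{R}_1)$, $\Pi_2=(\mathcal{A},\mathcal{E},\mathcal{R}_2)$ be ELPs. Then $\Pi_1$ and $\Pi_2$ are uniformly $W$-equivalent iff their $W$-UE-functions coincide.
   Context: Logic programs, interpretations, models, GL-reduct and answer sets $AS(\cdot)$ are as usual for disjunctive programs with (nested) default negation $\neg$. An ELP is a triple $(\mathcal{A},\mathcal{E},\mathcal{R})$: $\mathcal{A}$ atoms, $\mathcal{E}$ a set of epistemic literals $\mathbf{not}\,\ell$ ($\ell$ a literal over $\mathcal{A}$), $\mathcal{R}$ a finite set of rules $a_1\vee\cdots\vee a_k\leftarrow\ell_1,\dots,\ell_m,\xi_1,\dots,\xi_j,\neg\xi_{j+1},\dots,\neg\xi_n$ with $\xi_i\in\mathcal{E}$. For $D\subseteq\mathcal{A}$, $\Pi\cup D$ adds the facts $a\leftarrow$ ($a\in D$). For a guess $\Phi\subseteq\mathcal{E}$, the epistemic reduct $\Pi^\Phi$ replaces each $\mathbf{not}\,\ell\in\Phi$ by $\top$ and each remaining $\mathbf{not}$ by $\neg$ (giving an ordinary logic program). A set $\mathcal{I}$ of interpretations is $\Phi$-compatible w.r.t. $\mathcal{E}$ iff $\mathcal{I}\neq\emptyset$, each $\mathbf{not}\,\ell\in\Phi$ has some $I\in\mathcal{I}$ with $I\not\models\ell$, and each $\mathbf{not}\,\ell\in\mathcal{E}\setminus\Phi$ has $I\models\ell$ for all $I\in\mathcal{I}$.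 $\mathcal{M}$ is a candidate world view (CWV) of $\Pi$ w.r.t. $\Phi$ if $\mathcal{M}=AS(\Pi^\Phi)$ is $\Phi$-compatible; it is a world view (WV) if moreover no CWV of $\Pi$ has an associated guess $\Phi'\supsetneq\Phi$. ELPs are uniformly CWV- (resp. WV-) equivalent iff for every $D\subseteq\mathcal{A}$, $\Pi_1\cup D$ and $\Pi_2\cup D$ have the same CWVs (resp. WVs). The $W$-UE-function of $\Pi$ maps each pair $(\Phi,D)$ with $\Phi\subseteq\mathcal{E}$, $D\subseteq\mathcal{A}$ to $\mathcal{M}=AS((\Pi\cup D)^\Phi)$ if $\mathcal{M}$ is a CWV of type $W$ of $\Pi\cup D$ w.r.t. $\Phi$, and to $\emptyset$ otherwise. -}

module Defs where

open import Data.Nat using (ℕ)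
open import Data.Fin using (Fin)
open import Data.Fin.Subset using (Subset; _⊆_)
open import Data.Vec using (lookup)
open import Data.Bool using (Bool; true; false; not; _∧_; _∨_; if_then_else_)
open import Data.List using (List; []; _∷_; _++_; map; filterᵇ)
open import Data.Bool.ListAction using (any; all)
open import Data.List.Relation.Unary.All using (All)
open import Data.List using (allFin)
open import Data.Product using (Σ; _×_; ∃)
open import Data.Empty using (⊥)
open import Relation.Nullary using (¬_)
open import Relation.Binary.PropositionalEquality using (_≡_)
open import Function.Bundles using (_⇔_)
open import Level using (Level; suc; zero)

-- Atoms are Fin n (a finite set 𝒜 of n atoms).
-- Interpretations I ⊆ 𝒜 are Subset n (Vec Bool n).

data Lit (n : ℕ) : Set where
  pos : Fin n → Lit n
  neg : Fin n → Lit n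

data Fml (n : ℕ) : Set where
  atom : Fin n → Fml n
  top  : Fml n
  bot  : Fml n
  nt   : Fml n → Fml n

record Rule (n : ℕ) : Set where
  constructor rule
  field
    head : List (Fin n)
    body : List (Fml n)

Program : ℕ → Set
Program n = List (Rule n)

⟦_⟧ : ∀ {n} → Fml n → Subset n → Bool
⟦ atom a ⟧ I = lookup I a
⟦ top ⟧ I = true
⟦ bot ⟧ I = false
⟦ nt F ⟧ I = not (⟦ F ⟧ I)

ruleSat : ∀ {n} → Subset n → Rule n → Bool
ruleSat I (rule h b) = not (all (λ F → ⟦ F ⟧ I) b) ∨ any (lookup I) h

_⊨ᴾ_ : ∀ {n} → Subset n → Program n → Set
I ⊨ᴾ P = All (λ r → ruleSat I r ≡ true) P

-- GL-reduct for nested expressions (Lifschitz–Tang–Turner):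
-- every (maximal) ¬F is replaced by ⊤ if I ⊭ F, and by ⊥ otherwise.
reductF : ∀ {n} → Subset n → Fml n → Fml n
reductF I (atom a) = atom a
reductF I top = top
reductF I bot = bot
reductF I (nt F) = if ⟦ F ⟧ I then bot else top

reductR : ∀ {n} → Subset n → Rule n → Rule n
reductR I (rule h b) = rule h (map (reductF I) b)

GL : ∀ {n} → Program n → Subset n → Program n
GL P I = map (reductR I) P

AS : ∀ {n} → Program n → Subset n → Set
AS P I = (I ⊨ᴾ GL P I) × (∀ J → J ⊆ I → J ⊨ᴾ GL P I → I ⊆ J)

litF : ∀ {n} → Lit n → Fml n
litF (pos a) = atom a
litF (neg a) = nt (atom a)

_⊨ˡ_ : ∀ {n} → Subset n → Lit n → Set
I ⊨ˡ ℓ = ⟦ litF ℓ ⟧ I ≡ true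

-- body elements of ELP rules: ℓ, ξ = not ℓ, and ¬ξ = ¬ not ℓ
data EBody (n : ℕ) : Set where
  lit  : Lit n → EBody n
  epi  : Lit n → EBody n
  nepi : Lit n → EBody n

record ERule (n : ℕ) : Set where
  constructor erule
  field
    head : List (Fin n)
    body : List (EBody n)

data OccursIn {n : ℕ} (ℓ : Lit n) : EBody n → Set where
  in-epi  : OccursIn ℓ (epi ℓ)
  in-nepi : OccursIn ℓ (nepi ℓ)

-- Sets of epistemic literals (𝓔, guesses Φ) are represented by their
-- characteristic functions on literals: ℓ ↦ (not ℓ ∈ set).
ESet : ℕ → Set
ESet n = Lit n → Bool

_⊆ᴱ_ : ∀ {n} → ESet n → ESet n → Set
Φ ⊆ᴱ Ψ = ∀ ℓ → Φ ℓ ≡ true → Ψ ℓ ≡ true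

_⊊ᴱ_ : ∀ {n} → ESet n → ESet n → Set
Φ ⊊ᴱ Ψ = (Φ ⊆ᴱ Ψ) × ∃ λ ℓ → (Ψ ℓ ≡ true) × (Φ ℓ ≡ false)

record ELP (n : ℕ) (E : ESet n) : Set where
  field
    R  : List (ERule n)
    wf : All (λ r → All (λ β → ∀ ℓ → OccursIn ℓ β → E ℓ ≡ true) (ERule.body r)) R
open ELP public

facts : ∀ {n} → Subset n → List (ERule n)
facts {n} D = map (λ a → erule (a ∷ []) []) (filterᵇ (lookup D) (allFin n))

_∪ᴰ_ : ∀ {n} → List (ERule n) → Subset n → List (ERule n)
R ∪ᴰ D = R ++ facts D

ereductB : ∀ {n} → ESet n → EBody n → Fml n
ereductB Φ (lit ℓ)  = litF ℓ
ereductB Φ (epi ℓ)  = if Φ ℓ then top else nt (litF ℓ)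
ereductB Φ (nepi ℓ) = nt (if Φ ℓ then top else nt (litF ℓ))

ereduct : ∀ {n} → List (ERule n) → ESet n → Program n
ereduct R Φ = map (λ r → rule (ERule.head r) (map (ereductB Φ) (ERule.body r))) R

ISet : ℕ → Set₁
ISet n = Subset n → Set

Compatible : ∀ {n} → ESet n → ESet n → ISet n → Set
Compatible E Φ M =
    (∃ λ I → M I)
  × (∀ ℓ → Φ ℓ ≡ true → ∃ λ I → M I × ¬ (I ⊨ˡ ℓ))
  × (∀ ℓ → E ℓ ≡ true → Φ ℓ ≡ false → ∀ I → M I → I ⊨ˡ ℓ)

IsCWV : ∀ {n} → ESet n → List (ERule n) → ESet n → ISet n → Set
IsCWV E R Φ M = (∀ I → M I ⇔ AS (ereduct R Φ) I) × Compatible E Φ M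

IsWV : ∀ {n} → ESet n → List (ERule n) → ESet n → ISet n → Set₁
IsWV E R Φ M =
  IsCWV E R Φ M × (∀ Φ' M' → Φ' ⊆ᴱ E → Φ ⊊ᴱ Φ' → ¬ IsCWV E R Φ' M')

data WType : Set where
  CWV WV : WType

IsW : WType → ∀ {n} → ESet n → List (ERule n) → ESet n → ISet n → Set₁
IsW CWV E R Φ M = Level.Lift (suc zero) (IsCWV E R Φ M)
IsW WV  E R Φ M = IsWV E R Φ M

IsWOf : WType → ∀ {n} → ESet n → List (ERule n) → ISet n → Set₁
IsWOf W E R M = ∃ λ Φ → (Φ ⊆ᴱ E) × IsW W E R Φ M

UniformlyEquivalent : WType → ∀ {n} {E : ESet n} → ELP n E → ELP n E → Set₁
UniformlyEquivalent W {n} {E} Π₁ Π₂ =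
  ∀ (D : Subset n) (M : ISet n) → IsWOf W E (R Π₁ ∪ᴰ D) M ⇔ IsWOf W E (R Π₂ ∪ᴰ D) M

-- W-UE-function: (Φ, D) ↦ AS((Π ∪ D)^Φ) if that set is a CWV of type W
-- of Π ∪ D w.r.t. Φ, and ↦ ∅ otherwise (given as a membership predicate).
UEfun : WType → ∀ {n} {E : ESet n} → ELP n E → ESet n → Subset n → Subset n → Set₁
UEfun W {n} {E} Π Φ D I =
  IsW W E (R Π ∪ᴰ D) Φ (AS (ereduct (R Π ∪ᴰ D) Φ)) × Level.Lift (suc zero) (AS (ereduct (R Π ∪ᴰ D) Φ) I)

UEfunsCoincide : WType → ∀ {n} {E : ESet n} → ELP n E → ELP n E → Set₁
UEfunsCoincide W {n} {E} Π₁ Π₂ =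
  ∀ (Φ : ESet n) → Φ ⊆ᴱ E → ∀ (D : Subset n) (I : Subset n) →
    UEfun W Π₁ Φ D I ⇔ UEfun W Π₂ Φ D I

module Submission where

open import Defs
open import Data.Nat using (ℕ)
open import Data.Bool using (true; false)
open import Data.Product using (_,_; proj₁; proj₂)
open import Data.List.Properties using (map-cong)
open import Data.Empty using (⊥-elim)
open import Function.Bundles using (_⇔_; mk⇔; Equivalence)
import Function.Properties.Equivalence as ⇔
open import Level using (lift; lower)
open import Relation.Binary.PropositionalEquality
  using (_≡_; refl; sym; trans; cong; _≗_)

open Equivalence

-- A candidate world view M of Π ∪ D w.r.t. Φ is AS((Π ∪ D)^Φ), and Φ ⊆ 𝓔 is
-- recovered from M as the set of 'not ℓ' falsified by some member of M.
-- Hence the W-world views of Π ∪ D are exactly the values of the W-UE-function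
-- at (Φ, D) that satisfy the W-condition, each carrying its unique guess.
-- Such a value is non-empty, so agreement of the UE-functions at one of its
-- members already transfers the W-condition from Π₁ to Π₂.

module _ {n : ℕ} where

  infix 4 _≋_

  _≋_ : ISet n → ISet n → Set
  M ≋ M′ = ∀ I → M I ⇔ M′ I

  ≋-sym : ∀ {M M′} → M ≋ M′ → M′ ≋ M
  ≋-sym M≋M′ I = ⇔.sym (M≋M′ I)

  ≋-trans : ∀ {M M′ M″} → M ≋ M′ → M′ ≋ M″ → M ≋ M″
  ≋-trans M≋M′ M′≋M″ I = ⇔.trans (M≋M′ I) (M′≋M″ I)

  ereductB-cong : ∀ {Φ Ψ : ESet n} → Φ ≗ Ψ → ∀ β → ereductB Φ β ≡ ereductB Ψ β
  ereductB-cong Φ≗Ψ (lit ℓ)  = refl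
  ereductB-cong Φ≗Ψ (epi ℓ)  rewrite Φ≗Ψ ℓ = refl
  ereductB-cong Φ≗Ψ (nepi ℓ) rewrite Φ≗Ψ ℓ = refl

  ereduct-cong : ∀ {Φ Ψ : ESet n} R → Φ ≗ Ψ → ereduct R Φ ≡ ereduct R Ψ
  ereduct-cong R Φ≗Ψ =
    map-cong (λ r → cong (rule (ERule.head r)) (map-cong (ereductB-cong Φ≗Ψ) (ERule.body r))) R

  AS-ereduct-cong : ∀ {Φ Ψ : ESet n} R → Φ ≗ Ψ → AS (ereduct R Φ) ≋ AS (ereduct R Ψ)
  AS-ereduct-cong R Φ≗Ψ I rewrite ereduct-cong R Φ≗Ψ = ⇔.refl

  Compatible-resp : ∀ {E Φ Ψ : ESet n} {M M′} →
    Φ ≗ Ψ → M ≋ M′ → Compatible E Φ M → Compatible E Ψ M′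
  Compatible-resp Φ≗Ψ M≋M′ ((I , I∈M) , witnessed , forced) =
      (I , to (M≋M′ I) I∈M)
    , (λ ℓ Ψℓ → let (J , J∈M , J⊭ℓ) = witnessed ℓ (trans (Φ≗Ψ ℓ) Ψℓ)
                 in J , to (M≋M′ J) J∈M , J⊭ℓ)
    , (λ ℓ Eℓ Ψℓ J J∈M′ → forced ℓ Eℓ (trans (Φ≗Ψ ℓ) Ψℓ) J (from (M≋M′ J) J∈M′))

  IsCWV-resp : ∀ {E Φ Ψ : ESet n} {R M M′} →
    Φ ≗ Ψ → M ≋ M′ → IsCWV E R Φ M → IsCWV E R Ψ M′
  IsCWV-resp {R = R} Φ≗Ψ M≋M′ (M≋AS , compatible) =
      ≋-trans (≋-sym M≋M′) (≋-trans M≋AS (AS-ereduct-cong R Φ≗Ψ))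
    , Compatible-resp Φ≗Ψ M≋M′ compatible

  IsW-resp : ∀ W {E Φ Ψ : ESet n} {R M M′} →
    Φ ≗ Ψ → M ≋ M′ → IsW W E R Φ M → IsW W E R Ψ M′
  IsW-resp CWV Φ≗Ψ M≋M′ (lift cwv) = lift (IsCWV-resp Φ≗Ψ M≋M′ cwv)
  IsW-resp WV  Φ≗Ψ M≋M′ (cwv , maximal) =
      IsCWV-resp Φ≗Ψ M≋M′ cwv
    , λ Φ′ M″ Φ′⊆E (Ψ⊆Φ′ , ℓ , Φ′ℓ , Ψℓ) →
        maximal Φ′ M″ Φ′⊆E
          ((λ k Φk → Ψ⊆Φ′ k (trans (sym (Φ≗Ψ k)) Φk)) , ℓ , Φ′ℓ , trans (Φ≗Ψ ℓ) Ψℓ)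

  IsW⇒IsCWV : ∀ W {E Φ : ESet n} {R M} → IsW W E R Φ M → IsCWV E R Φ M
  IsW⇒IsCWV CWV (lift cwv) = cwv
  IsW⇒IsCWV WV  (cwv , _)  = cwv

  IsW⇒≋AS : ∀ W {E Φ : ESet n} {R M} → IsW W E R Φ M → M ≋ AS (ereduct R Φ)
  IsW⇒≋AS W w = proj₁ (IsW⇒IsCWV W w)

  IsW⇒IsW-AS : ∀ W {E Φ : ESet n} {R M} → IsW W E R Φ M → IsW W E R Φ (AS (ereduct R Φ))
  IsW⇒IsW-AS W w = IsW-resp W (λ _ → refl) (IsW⇒≋AS W w) w

  Compatible-guess-unique : ∀ {E Φ Ψ : ESet n} {M} → Φ ⊆ᴱ E → Ψ ⊆ᴱ E →
    Compatible E Φ M → Compatible E Ψ M → Φ ≗ Ψ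
  Compatible-guess-unique {Φ = Φ} {Ψ} Φ⊆E Ψ⊆E (_ , witnessedΦ , forcedΦ) (_ , witnessedΨ , forcedΨ) ℓ
    with Φ ℓ in Φℓ | Ψ ℓ in Ψℓ
  ... | true  | true  = refl
  ... | false | false = refl
  ... | true  | false = let (I , I∈M , I⊭ℓ) = witnessedΦ ℓ Φℓ
                        in ⊥-elim (I⊭ℓ (forcedΨ ℓ (Φ⊆E ℓ Φℓ) Ψℓ I I∈M))
  ... | false | true  = let (I , I∈M , I⊭ℓ) = witnessedΨ ℓ Ψℓ
                        in ⊥-elim (I⊭ℓ (forcedΦ ℓ (Ψ⊆E ℓ Ψℓ) Φℓ I I∈M))

  IsWOf⇒IsW : ∀ W {E Φ : ESet n} {R M} → Φ ⊆ᴱ E → Compatible E Φ M →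
    IsWOf W E R M → IsW W E R Φ M
  IsWOf⇒IsW W Φ⊆E compatible (Ψ , Ψ⊆E , w) =
    IsW-resp W (Compatible-guess-unique Ψ⊆E Φ⊆E (proj₂ (IsW⇒IsCWV W w)) compatible) (λ _ → ⇔.refl) w

module _ (W : WType) {n : ℕ} {E : ESet n} where

  UniformlyEquivalent-sym : ∀ (Π₁ Π₂ : ELP n E) →
    UniformlyEquivalent W Π₁ Π₂ → UniformlyEquivalent W Π₂ Π₁
  UniformlyEquivalent-sym _ _ ue D M = ⇔.sym (ue D M)

  UEfunsCoincide-sym : ∀ (Π₁ Π₂ : ELP n E) →
    UEfunsCoincide W Π₁ Π₂ → UEfunsCoincide W Π₂ Π₁
  UEfunsCoincide-sym _ _ co Φ Φ⊆E D I = ⇔.sym (co Φ Φ⊆E D I)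

  UniformlyEquivalent⇒UEfun⊆ : ∀ (Π₁ Π₂ : ELP n E) → UniformlyEquivalent W Π₁ Π₂ →
    ∀ {Φ} → Φ ⊆ᴱ E → ∀ D I → UEfun W Π₁ Φ D I → UEfun W Π₂ Φ D I
  UniformlyEquivalent⇒UEfun⊆ Π₁ Π₂ ue {Φ} Φ⊆E D I (w₁ , lift I∈AS₁) =
    IsW⇒IsW-AS W w₂ , lift (to (IsW⇒≋AS W w₂ I) I∈AS₁)
    where
    w₂ : IsW W E (R Π₂ ∪ᴰ D) Φ (AS (ereduct (R Π₁ ∪ᴰ D) Φ))
    w₂ = IsWOf⇒IsW W Φ⊆E (proj₂ (IsW⇒IsCWV W w₁)) (to (ue D _) (Φ , Φ⊆E , w₁))

  UEfunsCoincide⇒IsWOf⊆ : ∀ (Π₁ Π₂ : ELP n E) → UEfunsCoincide W Π₁ Π₂ →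
    ∀ D M → IsWOf W E (R Π₁ ∪ᴰ D) M → IsWOf W E (R Π₂ ∪ᴰ D) M
  UEfunsCoincide⇒IsWOf⊆ Π₁ Π₂ co D M (Φ , Φ⊆E , w) =
    Φ , Φ⊆E , IsW-resp W (λ _ → refl) (≋-sym (≋-trans M≋AS₁ AS₁≋AS₂)) w₂
    where
    AS₁ AS₂ : ISet n
    AS₁ = AS (ereduct (R Π₁ ∪ᴰ D) Φ)
    AS₂ = AS (ereduct (R Π₂ ∪ᴰ D) Φ)

    M≋AS₁ : M ≋ AS₁
    M≋AS₁ = IsW⇒≋AS W w

    w₁ : IsW W E (R Π₁ ∪ᴰ D) Φ AS₁
    w₁ = IsW⇒IsW-AS W w

    w₂ : IsW W E (R Π₂ ∪ᴰ D) Φ AS₂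
    w₂ with IsW⇒IsCWV W w
    ... | _ , (I₀ , I₀∈M) , _ = proj₁ (to (co Φ Φ⊆E D I₀) (w₁ , lift (to (M≋AS₁ I₀) I₀∈M)))

    AS₁≋AS₂ : AS₁ ≋ AS₂
    AS₁≋AS₂ I = mk⇔
      (λ I∈AS₁ → lower (proj₂ (to (co Φ Φ⊆E D I) (w₁ , lift I∈AS₁))))
      (λ I∈AS₂ → lower (proj₂ (from (co Φ Φ⊆E D I) (w₂ , lift I∈AS₂))))

theorem2 : ∀ (W : WType) {n : ℕ} {E : ESet n} (Π₁ Π₂ : ELP n E) →
    UniformlyEquivalent W Π₁ Π₂ ⇔ UEfunsCoincide W Π₁ Π₂
theorem2 W Π₁ Π₂ = mk⇔
  (λ ue Φ Φ⊆E D I → mk⇔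
    (UniformlyEquivalent⇒UEfun⊆ W Π₁ Π₂ ue Φ⊆E D I)
    (UniformlyEquivalent⇒UEfun⊆ W Π₂ Π₁ (UniformlyEquivalent-sym W Π₁ Π₂ ue) Φ⊆E D I))
  (λ co D M → mk⇔
    (UEfunsCoincide⇒IsWOf⊆ W Π₁ Π₂ co D M)
    (UEfunsCoincide⇒IsWOf⊆ W Π₂ Π₁ (UEfunsCoincide-sym W Π₁ Π₂ co) D M))
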